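{- Let $G$ be a connected graph of order at least $2$ that has a minimum dominating set $D$ with $c(D)\neq \emptyset$. Then $G \,\square\, H$ is not well-dominated for every connected graph $H$ of order at least $2$.
   Context: All graphs are finite, simple and undirected. A dominating set of $X$ is a set $D$ of vertices such that every vertex is in $D$ or adjacent to a vertex of $D$; $\gamma(X)$ is the minimum size of a dominating set (a minimum dominating set has this size), $\Gamma(X)$ the maximum size of an inclusion-minimal dominating set; $X$ is well-dominated if $\gamma(X)=\Gamma(X)$. For $u\in A\subseteq V(X)$, $\mathrm{pn}[u,A]=\{x\in V(X): N[x]\cap A=\{u\}\}$, and for a dominating set $D$, $c(D)=\{x\in D: \mathrm{pn}[x,D]=\{x\}\}$. The Cartesian product $G\,\square\, H$ has vertex set $V(G)\times V(H)$, with $(g_1,h_1)\sim(g_2,h_2)$ iff either $g_1=g_2$ and $h_1h_2\in E(H)$, or $h_1=h_2$ and $g_1g_2\in E(G)$. -}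

module Defs where

open import Data.Nat using (ℕ; _*_; _≤_)
open import Data.Fin using (Fin; remQuot)
open import Data.Fin.Subset using (Subset; _∈_; _⊂_; ∣_∣)
open import Data.Product using (Σ; ∃; _×_; _,_; proj₁; proj₂)
open import Data.Sum using (_⊎_)
open import Relation.Binary.PropositionalEquality using (_≡_)
open import Relation.Nullary using (¬_)
open import Function.Bundles using (_⇔_)

Graph : ℕ → Set₁
Graph n = Fin n → Fin n → Set

IsSimple : ∀ {n} → Graph n → Set
IsSimple {n} G = (∀ (u v : Fin n) → G u v → G v u) × (∀ (u : Fin n) → ¬ G u u)

data Reach {n} (G : Graph n) : Fin n → Fin n → Set where
  here : ∀ {u} → Reach G u u
  step : ∀ {u v w} → G u v → Reach G v w → Reach G u w

Connected : ∀ {n} → Graph n → Set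
Connected {n} G = ∀ (u v : Fin n) → Reach G u v

-- closed neighbourhood: x ∈ N[y]
InN : ∀ {n} → Graph n → Fin n → Fin n → Set
InN G y x = x ≡ y ⊎ G y x

Dominating : ∀ {n} → Graph n → Subset n → Set
Dominating {n} G D = ∀ (x : Fin n) → ∃ λ d → d ∈ D × InN G x d

MinimalDominating : ∀ {n} → Graph n → Subset n → Set
MinimalDominating G D = Dominating G D × (∀ D' → D' ⊂ D → ¬ Dominating G D')

MinimumDominating : ∀ {n} → Graph n → Subset n → Set
MinimumDominating G D = Dominating G D × (∀ D' → Dominating G D' → ∣ D ∣ ≤ ∣ D' ∣)

IsDominationNumber : ∀ {n} → Graph n → ℕ → Set
IsDominationNumber G k =
  (∃ λ D → Dominating G D × ∣ D ∣ ≡ k) × (∀ D → Dominating G D → k ≤ ∣ D ∣)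

IsUpperDominationNumber : ∀ {n} → Graph n → ℕ → Set
IsUpperDominationNumber G k =
  (∃ λ D → MinimalDominating G D × ∣ D ∣ ≡ k) × (∀ D → MinimalDominating G D → ∣ D ∣ ≤ k)

WellDominated : ∀ {n} → Graph n → Set
WellDominated G = ∃ λ k → IsDominationNumber G k × IsUpperDominationNumber G k

-- x ∈ pn[u, A]  iff  N[x] ∩ A = {u}
InPN : ∀ {n} → Graph n → Fin n → Subset n → Fin n → Set
InPN {n} G u A x = ∀ (y : Fin n) → (InN G x y × y ∈ A) ⇔ (y ≡ u)

-- x ∈ c(D)  iff  x ∈ D and pn[x, D] = {x}
InC : ∀ {n} → Graph n → Subset n → Fin n → Set
InC {n} G D x = x ∈ D × (∀ (z : Fin n) → InPN G x D z ⇔ (z ≡ x))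

_□_ : ∀ {n m} → Graph n → Graph m → Graph (n * m)
_□_ {n} {m} G H a b with remQuot {n} m a | remQuot {n} m b
... | (g₁ , h₁) | (g₂ , h₂) = (g₁ ≡ g₂ × H h₁ h₂) ⊎ (h₁ ≡ h₂ × G g₁ g₂)

module Submission where

-- Let D be a minimum dominating set of G with x ∈ c(D), and vu an edge of H. Every vertex
-- dominated only by (x , v) within D × V(H) is (x , v) itself, which (x , u) also dominates,
-- so γ(G □ H) < γ(G) |V(H)|. On the other hand, by the exchange argument of Bollobás and
-- Cockayne, G, having no isolated vertices, has a minimum dominating set D′ whose vertices all
-- have external private neighbours; then D′ × V(H) is a minimal dominating set of G □ H,
-- so Γ(G □ H) ≥ γ(G) |V(H)|.

open import Defs
open import Data.Nat using (zero; suc; _≤_; _<_; _+_; _*_; z≤n; s≤s; s≤s⁻¹)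
open import Data.Nat.Properties
  using (+-comm; ≤-trans; ≤-reflexive; ≤-refl; +-suc; +-monoʳ-≤; <-≤-trans; <-irrefl; *-monoˡ-≤; module ≤-Reasoning)
open import Data.Fin using (Fin; zero; suc; remQuot; combine; _≟_; punchIn; fromℕ<)
open import Data.Fin.Properties using (remQuot-combine; combine-remQuot; combine-injective; punchInᵢ≢i)
open import Data.Fin.Subset using (Subset; _∈_; _∉_; _⊂_; ∣_∣; _-_; _─_; _∪_; ⁅_⁆; inside; outside)
open import Data.Fin.Subset.Properties
  using (∣p∣≤∣x∷p∣; x∈⁅x⁆; x∈⁅y⁆⇒x≡y; ∣⁅x⁆∣≡1; ∣⊤∣≡n; ∣⊥∣≡0; x∈p∪q⁺; x∈p∪q⁻; p─q⊆p;
         x∈p∧x≢y⇒x∈p-y; x∈p⇒∣p-x∣<∣p∣; _∈?_)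
open import Data.Vec using ([]; _∷_; _++_; replicate; lookup; there)
open import Data.Vec.Properties using (lookup-++ˡ; lookup-++ʳ; lookup-replicate; []=⇒lookup; lookup⇒[]=)
open import Data.Product using (∃; _×_; _,_; proj₁; proj₂)
open import Data.Sum using (_⊎_; inj₁; inj₂)
open import Data.Empty using (⊥-elim)
open import Effect.Monad using (RawMonad)
open import Level using (0ℓ)
open import Function using (id; _∘_)
open import Function.Bundles using (Equivalence; mk⇔)
open import Relation.Binary.PropositionalEquality
  using (_≡_; _≢_; refl; sym; trans; cong; cong₂; subst)
open import Relation.Nullary using (¬_; yes; no)
open import Relation.Nullary.Negation using (¬¬-Monad)

-- Adjacency is not assumed decidable, so the argument runs in the double-negation monad;
-- this suffices since the conclusion is a negation.
open RawMonad (¬¬-Monad {0ℓ}) using (_>>=_; pure)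

¬¬-pull : ∀ {n} {P : Fin n → Set} → (∀ i → ¬ ¬ P i) → ¬ ¬ (∀ i → P i)
¬¬-pull {zero}  ¬¬P k = k λ ()
¬¬-pull {suc n} ¬¬P k = ¬¬P zero λ P₀ → ¬¬-pull (λ i → ¬¬P (suc i)) λ Pₛ →
  k λ { zero → P₀ ; (suc i) → Pₛ i }

¬¬-∀∈⊎∃∈¬ : ∀ {n} {P : Fin n → Set} (D : Subset n) →
            ¬ ¬ ((∀ i → i ∈ D → P i) ⊎ ∃ λ i → i ∈ D × ¬ P i)
¬¬-∀∈⊎∃∈¬ D k = ¬¬-pull
  (λ i ¬[i∈D→Pi] → ¬[i∈D→Pi] λ i∈D → ⊥-elim (k (inj₂ (i , i∈D , λ Pi → ¬[i∈D→Pi] λ _ → Pi))))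
  (λ all → k (inj₁ all))

x∈p─q⇒x∉q : ∀ {n} {x : Fin n} (p q : Subset n) → x ∈ p ─ q → x ∉ q
x∈p─q⇒x∉q {x = zero}  (_ ∷ p) (inside  ∷ q) ()
x∈p─q⇒x∉q {x = zero}  (_ ∷ p) (outside ∷ q) _ ()
x∈p─q⇒x∉q {x = suc x} (_ ∷ p) (_ ∷ q) (there x∈p─q) (there x∈q) = x∈p─q⇒x∉q p q x∈p─q x∈q

∣p∪q∣≤∣p∣+∣q∣ : ∀ {n} (p q : Subset n) → ∣ p ∪ q ∣ ≤ ∣ p ∣ + ∣ q ∣
∣p∪q∣≤∣p∣+∣q∣ []            []            = z≤n
∣p∪q∣≤∣p∣+∣q∣ (inside  ∷ p) (t ∷ q)       = s≤s (≤-trans (∣p∪q∣≤∣p∣+∣q∣ p q) (+-monoʳ-≤ ∣ p ∣ (∣p∣≤∣x∷p∣ t q)))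
∣p∪q∣≤∣p∣+∣q∣ (outside ∷ p) (inside  ∷ q) = ≤-trans (s≤s (∣p∪q∣≤∣p∣+∣q∣ p q)) (≤-reflexive (sym (+-suc ∣ p ∣ ∣ q ∣)))
∣p∪q∣≤∣p∣+∣q∣ (outside ∷ p) (outside ∷ q) = ∣p∪q∣≤∣p∣+∣q∣ p q

∣p++q∣≡∣p∣+∣q∣ : ∀ {a b} (p : Subset a) (q : Subset b) → ∣ p ++ q ∣ ≡ ∣ p ∣ + ∣ q ∣
∣p++q∣≡∣p∣+∣q∣ []            q = refl
∣p++q∣≡∣p∣+∣q∣ (inside  ∷ p) q = cong suc (∣p++q∣≡∣p∣+∣q∣ p q)
∣p++q∣≡∣p∣+∣q∣ (outside ∷ p) q = ∣p++q∣≡∣p∣+∣q∣ p q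

Reach⇒∃edge : ∀ {n} {G : Graph n} {u v} → Reach G u v → u ≢ v → ∃ (G u)
Reach⇒∃edge here              u≢u = ⊥-elim (u≢u refl)
Reach⇒∃edge (step {v = w} uw _) _ = w , uw

Connected⇒∃neighbour : ∀ {n} {G : Graph n} → Connected G → 2 ≤ n → ∀ u → ∃ (G u)
Connected⇒∃neighbour {suc (suc _)} connected (s≤s (s≤s _)) u =
  Reach⇒∃edge (connected u (punchIn u zero)) (λ u≡v → punchInᵢ≢i u zero (sym u≡v))

IsolatedIn : ∀ {n} → Graph n → Subset n → Fin n → Set
IsolatedIn G D d = ∀ e → e ∈ D → ¬ G d e

HasExternalPrivateNeighbour : ∀ {n} → Graph n → Subset n → Fin n → Set
HasExternalPrivateNeighbour G D d = ∃ λ p → p ∉ D × InPN G d D p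

InPN⇒unique : ∀ {n} {G : Graph n} {d D p e} → InPN G d D p → e ∈ D → InN G p e → e ≡ d
InPN⇒unique p∈pn e∈D pe = Equivalence.to (p∈pn _) (pe , e∈D)

¬InPN⇒another-dominator : ∀ {n} {G : Graph n} {D d a} → d ∈ D → InN G a d → ¬ InPN G d D a →
                          ¬ ¬ ∃ λ f → f ∈ D × f ≢ d × InN G a f
¬InPN⇒another-dominator {G = G} {D} {d} {a} d∈D ad a∉pn no-other = a∉pn λ y → mk⇔ (only-d y) (d-dominates y)
  where
  only-d : ∀ y → InN G a y × y ∈ D → y ≡ d
  only-d y (ay , y∈D) with y ≟ d
  ... | yes y≡d = y≡d
  ... | no  y≢d = ⊥-elim (no-other (y , y∈D , y≢d , ay))
  d-dominates : ∀ y → y ≡ d → InN G a y × y ∈ D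
  d-dominates y refl = ad , d∈D

InN⇒adjacent : ∀ {n} {G : Graph n} {a d} → a ≢ d → InN G a d → G a d
InN⇒adjacent a≢d (inj₁ d≡a) = ⊥-elim (a≢d (sym d≡a))
InN⇒adjacent a≢d (inj₂ ad)  = ad

replace : ∀ {n} → Subset n → Fin n → Fin n → Subset n
replace D d w = (D - d) ∪ ⁅ w ⁆

module _ {n} {D : Subset n} {d w : Fin n} where

  ∈-replace⁺ˡ : ∀ {e} → e ∈ D → e ≢ d → e ∈ replace D d w
  ∈-replace⁺ˡ e∈D e≢d = x∈p∪q⁺ (inj₁ (x∈p∧x≢y⇒x∈p-y e∈D e≢d))

  ∈-replace⁺ʳ : w ∈ replace D d w
  ∈-replace⁺ʳ = x∈p∪q⁺ (inj₂ (x∈⁅x⁆ w))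

  ∈-replace⁻ : ∀ {e} → e ∈ replace D d w → (e ∈ D × e ≢ d) ⊎ e ≡ w
  ∈-replace⁻ e∈D′ with x∈p∪q⁻ (D - d) ⁅ w ⁆ e∈D′
  ... | inj₁ e∈D-d = inj₁ (p─q⊆p D ⁅ d ⁆ e∈D-d , λ { refl → x∈p─q⇒x∉q D ⁅ d ⁆ e∈D-d (x∈⁅x⁆ d) })
  ... | inj₂ e∈⁅w⁆ = inj₂ (x∈⁅y⁆⇒x≡y w e∈⁅w⁆)

  ∣replace∣≤∣p∣ : d ∈ D → ∣ replace D d w ∣ ≤ ∣ D ∣
  ∣replace∣≤∣p∣ d∈D = begin
    ∣ replace D d w ∣      ≤⟨ ∣p∪q∣≤∣p∣+∣q∣ (D - d) ⁅ w ⁆ ⟩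
    ∣ D - d ∣ + ∣ ⁅ w ⁆ ∣  ≡⟨ cong (∣ D - d ∣ +_) (∣⁅x⁆∣≡1 w) ⟩
    ∣ D - d ∣ + 1          ≡⟨ +-comm ∣ D - d ∣ 1 ⟩
    suc ∣ D - d ∣          ≤⟨ x∈p⇒∣p-x∣<∣p∣ d∈D ⟩
    ∣ D ∣                  ∎
    where open ≤-Reasoning

module _ {n} {G : Graph n} (simple : IsSimple G) where

  private
    symmetric : ∀ {u v} → G u v → G v u
    symmetric = proj₁ simple _ _

    irreflexive : ∀ {u} → ¬ G u u
    irreflexive = proj₂ simple _

  -- If d had a neighbour in D, then D - d would still dominate: every vertex outside D
  -- dominated by d is not its private neighbour, so it has a second dominator.
  no-private-neighbour⇒isolated : ∀ {D d} → MinimumDominating G D → d ∈ D →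
                                  ¬ HasExternalPrivateNeighbour G D d → IsolatedIn G D d
  no-private-neighbour⇒isolated {D} {d} (dominating , minimum) d∈D no-epn e e∈D de =
    ¬¬-pull dominator (λ dom → <-irrefl refl (<-≤-trans (x∈p⇒∣p-x∣<∣p∣ d∈D) (minimum (D - d) dom)))
    where
    dominator : ∀ a → ¬ ¬ ∃ λ f → f ∈ D - d × InN G a f
    dominator a with dominating a
    ... | f , f∈D , af with f ≟ d
    ...   | no f≢d = pure (f , x∈p∧x≢y⇒x∈p-y f∈D f≢d , af)
    ...   | yes refl with a ≟ d | a ∈? D
    ...     | yes refl | _      = pure (e , x∈p∧x≢y⇒x∈p-y e∈D (λ { refl → irreflexive de }) , inj₂ de)
    ...     | no  a≢d | yes a∈D = pure (a , x∈p∧x≢y⇒x∈p-y a∈D a≢d , inj₁ refl)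
    ...     | no  a≢d | no  a∉D = do
      f′ , f′∈D , f′≢d , af′ ← ¬InPN⇒another-dominator {G = G} d∈D af (λ a∈pn → no-epn (a , a∉D , a∈pn))
      pure (f′ , x∈p∧x≢y⇒x∈p-y f′∈D f′≢d , af′)

  module Exchange {D d w} (minimumD : MinimumDominating G D) (d∈D : d ∈ D)
                  (no-epn : ¬ HasExternalPrivateNeighbour G D d) (dw : G d w) where

    D′ : Subset n
    D′ = replace D d w

    d-isolated : IsolatedIn G D d
    d-isolated = no-private-neighbour⇒isolated minimumD d∈D no-epn

    w∉D : w ∉ D
    w∉D w∈D = d-isolated w w∈D dw

    another-dominator : ∀ {a} → a ∉ D → InN G a d → ¬ ¬ ∃ λ f → f ∈ D × f ≢ d × InN G a f
    another-dominator a∉D ad = ¬InPN⇒another-dominator {G = G} d∈D ad (λ a∈pn → no-epn (_ , a∉D , a∈pn))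

    dominating : ¬ ¬ Dominating G D′
    dominating = ¬¬-pull dominator
      where
      dominator : ∀ a → ¬ ¬ ∃ λ f → f ∈ D′ × InN G a f
      dominator a with proj₁ minimumD a
      ... | f , f∈D , af with f ≟ d
      ...   | no f≢d = pure (f , ∈-replace⁺ˡ f∈D f≢d , af)
      ...   | yes refl with a ≟ d
      ...     | yes refl = pure (w , ∈-replace⁺ʳ , inj₂ dw)
      ...     | no  a≢d  = do
        let ad = InN⇒adjacent {G = G} a≢d af
        f′ , f′∈D , f′≢d , af′ ← another-dominator (λ a∈D → d-isolated a a∈D (symmetric ad)) (inj₂ ad)
        pure (f′ , ∈-replace⁺ˡ f′∈D f′≢d , af′)

    minimum : ¬ ¬ MinimumDominating G D′
    minimum = do
      dom ← dominating
      pure (dom , λ D″ dom″ → ≤-trans (∣replace∣≤∣p∣ d∈D) (proj₂ minimumD D″ dom″))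

    w-not-isolated : ¬ IsolatedIn G D′ w
    w-not-isolated w-isolated with proj₁ minimumD w
    ... | f , f∈D , inj₁ refl = w∉D f∈D
    ... | f , f∈D , inj₂ wf with f ≟ d
    ...   | no  f≢d  = w-isolated f (∈-replace⁺ˡ f∈D f≢d) wf
    ...   | yes refl = another-dominator w∉D (inj₂ wf) λ where
            (f′ , f′∈D , f′≢d , inj₁ refl) → w∉D f′∈D
            (f′ , f′∈D , f′≢d , inj₂ wf′)  → w-isolated f′ (∈-replace⁺ˡ f′∈D f′≢d) wf′

    isolated-shrinks : ∀ {I} → (∀ e → e ∈ D → IsolatedIn G D e → e ∈ I) →
                       ∀ e → e ∈ D′ → IsolatedIn G D′ e → e ∈ I - d
    isolated-shrinks isolated⊆I e e∈D′ e-isolated′ with ∈-replace⁻ e∈D′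
    ... | inj₂ refl         = ⊥-elim (w-not-isolated e-isolated′)
    ... | inj₁ (e∈D , e≢d) = x∈p∧x≢y⇒x∈p-y (isolated⊆I e e∈D e-isolated) e≢d
      where
      e-isolated : IsolatedIn G D e
      e-isolated f f∈D ef with f ≟ d
      ... | yes refl = d-isolated e e∈D (symmetric ef)
      ... | no  f≢d  = e-isolated′ f (∈-replace⁺ˡ f∈D f≢d) ef

  private
    -- I contains every vertex isolated in D, and each exchange removes the exchanged vertex from I.
    exchange-loop : (∀ u → ∃ (G u)) → ∀ t {I D} → ∣ I ∣ < t → MinimumDominating G D →
                    (∀ e → e ∈ D → IsolatedIn G D e → e ∈ I) →
                    ¬ ¬ ∃ λ D′ → MinimumDominating G D′ ×
                                 (∀ d → d ∈ D′ → HasExternalPrivateNeighbour G D′ d)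
    exchange-loop neighbour zero () _ _
    exchange-loop neighbour (suc t) {D = D} ∣I∣<t minimumD isolated⊆I = ¬¬-∀∈⊎∃∈¬ D >>= λ where
      (inj₁ all-epn)           → pure (D , minimumD , all-epn)
      (inj₂ (d , d∈D , no-epn)) → do
        let open Exchange minimumD d∈D no-epn (proj₂ (neighbour d))
            d∈I = isolated⊆I d d∈D d-isolated
        minimumD′ ← minimum
        exchange-loop neighbour t (<-≤-trans (x∈p⇒∣p-x∣<∣p∣ d∈I) (s≤s⁻¹ ∣I∣<t)) minimumD′
                      (isolated-shrinks isolated⊆I)

  minimum-dominating-with-private-neighbours :
    (∀ u → ∃ (G u)) → ∀ {D} → MinimumDominating G D →
    ¬ ¬ ∃ λ D′ → MinimumDominating G D′ × (∀ d → d ∈ D′ → HasExternalPrivateNeighbour G D′ d)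
  minimum-dominating-with-private-neighbours neighbour {D} minimumD =
    exchange-loop neighbour (suc ∣ D ∣) ≤-refl minimumD (λ e e∈D _ → e∈D)

data ProductVertex {n m} : Fin (n * m) → Set where
  ⟨_,_⟩ : (g : Fin n) (h : Fin m) → ProductVertex (combine g h)

productVertex : ∀ {n m} (k : Fin (n * m)) → ProductVertex k
productVertex {n} {m} k =
  subst ProductVertex (combine-remQuot {n} m k) ⟨ proj₁ (remQuot {n} m k) , proj₂ (remQuot {n} m k) ⟩

-- cylinder m A is A × V(H) inside V(G □ H), whose vertex combine g h is the pair (g , h).
cylinder : ∀ {n} m → Subset n → Subset (n * m)
cylinder m []      = []
cylinder m (a ∷ A) = replicate m a ++ cylinder m A

lookup-cylinder : ∀ {n m} (A : Subset n) g (h : Fin m) → lookup (cylinder m A) (combine g h) ≡ lookup A g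
lookup-cylinder {m = m} (a ∷ A) zero    h =
  trans (lookup-++ˡ (replicate m a) (cylinder m A) h) (lookup-replicate h a)
lookup-cylinder {m = m} (a ∷ A) (suc g) h =
  trans (lookup-++ʳ (replicate m a) (cylinder m A) (combine g h)) (lookup-cylinder A g h)

∈-cylinder⁺ : ∀ {n m} {A : Subset n} {g} (h : Fin m) → g ∈ A → combine g h ∈ cylinder m A
∈-cylinder⁺ {A = A} {g} h g∈A = lookup⇒[]= _ _ (trans (lookup-cylinder A g h) ([]=⇒lookup g∈A))

∈-cylinder⁻ : ∀ {n m} {A : Subset n} {g} {h : Fin m} → combine g h ∈ cylinder m A → g ∈ A
∈-cylinder⁻ {A = A} {g} {h} gh∈ = lookup⇒[]= _ _ (trans (sym (lookup-cylinder A g h)) ([]=⇒lookup gh∈))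

∣cylinder∣ : ∀ {n} m (A : Subset n) → ∣ cylinder m A ∣ ≡ ∣ A ∣ * m
∣cylinder∣ m []            = refl
∣cylinder∣ m (inside  ∷ A) =
  trans (∣p++q∣≡∣p∣+∣q∣ (replicate m inside) (cylinder m A)) (cong₂ _+_ (∣⊤∣≡n m) (∣cylinder∣ m A))
∣cylinder∣ m (outside ∷ A) =
  trans (∣p++q∣≡∣p∣+∣q∣ (replicate m outside) (cylinder m A)) (cong₂ _+_ (∣⊥∣≡0 m) (∣cylinder∣ m A))

module _ {n m} {G : Graph n} {H : Graph m} where

  □-combine : ∀ g h g′ h′ →
              (G □ H) (combine g h) (combine g′ h′) ≡ ((g ≡ g′ × H h h′) ⊎ (h ≡ h′ × G g g′))
  □-combine g h g′ h′ = cong₂ adjacent (remQuot-combine g h) (remQuot-combine g′ h′)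
    where
    adjacent : Fin n × Fin m → Fin n × Fin m → Set
    adjacent (g , h) (g′ , h′) = (g ≡ g′ × H h h′) ⊎ (h ≡ h′ × G g g′)

  InN-□-horizontal : ∀ {g g′} h → InN G g g′ → InN (G □ H) (combine g h) (combine g′ h)
  InN-□-horizontal h (inj₁ refl) = inj₁ refl
  InN-□-horizontal {g} {g′} h (inj₂ gg′) = inj₂ (subst id (sym (□-combine g h g′ h)) (inj₂ (refl , gg′)))

  InN-□-vertical : ∀ g {h h′} → H h h′ → InN (G □ H) (combine g h) (combine g h′)
  InN-□-vertical g {h} {h′} hh′ = inj₂ (subst id (sym (□-combine g h g h′)) (inj₁ (refl , hh′)))

  cylinder-dominating : ∀ {D} → Dominating G D → Dominating (G □ H) (cylinder m D)
  cylinder-dominating dominating k with productVertex {n} {m} k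
  ... | ⟨ g , h ⟩ with dominating g
  ...   | f , f∈D , gf = combine f h , ∈-cylinder⁺ h f∈D , InN-□-horizontal h gf

  -- (d , h) is the only vertex of the cylinder dominating (p , h), for p an external private
  -- neighbour of d.
  cylinder-minimal : ∀ {D} → Dominating G D → (∀ d → d ∈ D → HasExternalPrivateNeighbour G D d) →
                     MinimalDominating (G □ H) (cylinder m D)
  cylinder-minimal {D} dominating epn =
    cylinder-dominating dominating , not-dominating
    where
    not-dominating : ∀ D′ → D′ ⊂ cylinder m D → ¬ Dominating (G □ H) D′
    not-dominating D′ (D′⊆ , z , z∈ , z∉D′) dominating′ with productVertex {n} {m} z
    ... | ⟨ d , h ⟩ with epn d (∈-cylinder⁻ z∈)
    ...   | p , p∉D , p∈pn with dominating′ (combine p h)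
    ...     | e , e∈D′ , ph-e with productVertex {n} {m} e
    ...       | ⟨ g , h′ ⟩ with ph-e
    ...         | inj₁ eq = p∉D (subst (_∈ D) (proj₁ (combine-injective g h′ p h eq)) (∈-cylinder⁻ (D′⊆ e∈D′)))
    ...         | inj₂ adj with subst id (□-combine p h g h′) adj
    ...           | inj₁ (refl , _)  = p∉D (∈-cylinder⁻ (D′⊆ e∈D′))
    ...           | inj₂ (refl , pg) = z∉D′ (subst (λ g → combine g h ∈ D′) g≡d e∈D′)
      where
      g≡d : g ≡ d
      g≡d = InPN⇒unique {G = G} p∈pn (∈-cylinder⁻ (D′⊆ e∈D′)) (inj₂ pg)

  cylinder-minus-dominating : ∀ {D x u v} → Dominating G D → InC G D x → H v u → u ≢ v →
                              ¬ ¬ Dominating (G □ H) (cylinder m D - combine x v)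
  cylinder-minus-dominating {D} {x} {u} {v} dominating (x∈D , x∈cD) vu u≢v = ¬¬-pull dominator
    where
    ∈-cylinder-minus : ∀ {g h} → g ∈ D → g ≢ x ⊎ h ≢ v → combine g h ∈ cylinder m D - combine x v
    ∈-cylinder-minus {g} {h} g∈D (inj₁ g≢x) =
      x∈p∧x≢y⇒x∈p-y (∈-cylinder⁺ h g∈D) (g≢x ∘ proj₁ ∘ combine-injective g h x v)
    ∈-cylinder-minus {g} {h} g∈D (inj₂ h≢v) =
      x∈p∧x≢y⇒x∈p-y (∈-cylinder⁺ h g∈D) (h≢v ∘ proj₂ ∘ combine-injective g h x v)
    dominator : ∀ k → ¬ ¬ ∃ λ e → e ∈ cylinder m D - combine x v × InN (G □ H) k e
    dominator k with productVertex {n} {m} k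
    ... | ⟨ a , h ⟩ with dominating a
    ...   | f , f∈D , af with f ≟ x
    ...     | no f≢x = pure (combine f h , ∈-cylinder-minus f∈D (inj₁ f≢x) , InN-□-horizontal h af)
    ...     | yes refl with h ≟ v
    ...       | no h≢v = pure (combine f h , ∈-cylinder-minus f∈D (inj₂ h≢v) , InN-□-horizontal h af)
    ...       | yes refl with a ≟ x
    ...         | yes refl = pure (combine x u , ∈-cylinder-minus x∈D (inj₂ u≢v) , InN-□-vertical x vu)
    ...         | no  a≢x  = do
      f′ , f′∈D , f′≢x , af′ ← ¬InPN⇒another-dominator {G = G} x∈D af (λ a∈pn → a≢x (Equivalence.to (x∈cD a) a∈pn))
      pure (combine f′ v , ∈-cylinder-minus f′∈D (inj₁ f′≢x) , InN-□-horizontal v af′)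

proposition4 : ∀ {n} (G : Graph n) → IsSimple G → Connected G → 2 ≤ n →
    (∃ λ (D : Subset n) → MinimumDominating G D × ∃ λ x → InC G D x) →
    ∀ {m} (H : Graph m) → IsSimple H → Connected H → 2 ≤ m →
    ¬ WellDominated (G □ H)
proposition4 G simpleG connectedG 2≤n (D , minimumD , x , x∈cD) {m} H simpleH connectedH 2≤m
             (k , (_ , k≤γ) , (_ , Γ≤k)) =
  minimum-dominating-with-private-neighbours simpleG (Connected⇒∃neighbour connectedG 2≤n) minimumD
    λ (D′ , minimumD′ , epn) →
  cylinder-minus-dominating {G = G} {H} (proj₁ minimumD) x∈cD vu u≢v
    λ dominating → <-irrefl refl (begin-strict
      k                                   ≤⟨ k≤γ _ dominating ⟩
      ∣ cylinder m D - combine x v ∣      <⟨ x∈p⇒∣p-x∣<∣p∣ (∈-cylinder⁺ v (proj₁ x∈cD)) ⟩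
      ∣ cylinder m D ∣                    ≡⟨ ∣cylinder∣ m D ⟩
      ∣ D ∣ * m                           ≤⟨ *-monoˡ-≤ m (proj₂ minimumD D′ (proj₁ minimumD′)) ⟩
      ∣ D′ ∣ * m                          ≡⟨ ∣cylinder∣ m D′ ⟨
      ∣ cylinder m D′ ∣                   ≤⟨ Γ≤k _ (cylinder-minimal {G = G} {H} (proj₁ minimumD′) epn) ⟩
      k                                   ∎)
  where
  open ≤-Reasoning
  v : Fin m
  v = fromℕ< 2≤m
  u : Fin m
  u = proj₁ (Connected⇒∃neighbour connectedH 2≤m v)
  vu : H v u
  vu = proj₂ (Connected⇒∃neighbour connectedH 2≤m v)
  u≢v : u ≢ v
  u≢v u≡v = proj₂ simpleH v (subst (H v) u≡v vu)
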